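{- For every integer $n\geq 1$, \[ \sqrt{\sum_{k=0}^{n-1}F_{k-1}^{2}\mathbb{F}_{k}^{2}}\;\leq\; F_n\mathbb{F}_n-n\;\leq\;\sqrt{n\sum_{k=0}^{n-1}F_{k-1}^{2}\mathbb{F}_{k}^{2}}. \]
   Context: $F_n$ denotes the Fibonacci numbers: $F_0=0$, $F_1=1$, $F_{n+1}=F_n+F_{n-1}$ (extended backwards by the same recurrence, so $F_{ -1}=1$). The harmonic Fibonacci numbers are $\mathbb{F}_n=\sum_{k=1}^{n}\frac{1}{F_k}$ for $n\geq 1$, with $\mathbb{F}_0=0$. -}

module Defs where

open import Data.Nat as ℕ using (ℕ; zero; suc; _<_; z<s)
open import Data.Nat.Properties using (<-≤-trans; m≤m+n)
open import Data.Integer using (+_)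
open import Data.Rational using (ℚ; _/_; _+_; 0ℚ)

fib : ℕ → ℕ
fib zero = 0
fib (suc zero) = 1
fib (suc (suc n)) = fib (suc n) ℕ.+ fib n

-- F_{k-1} for k ≥ 0, with F_{-1} = 1
fibPrev : ℕ → ℕ
fibPrev zero = 1
fibPrev (suc k) = fib k

fib-suc-pos : ∀ k → 0 < fib (suc k)
fib-suc-pos zero = z<s
fib-suc-pos (suc k) = <-≤-trans (fib-suc-pos k) (m≤m+n (fib (suc k)) (fib k))

invFibSuc : ℕ → ℚ
invFibSuc k = ((+ 1) / fib (suc k)) {{ℕ.>-nonZero (fib-suc-pos k)}}

-- harmonic Fibonacci numbers: HF n = Σ_{k=1}^{n} 1/F_k, HF 0 = 0
HF : ℕ → ℚ
HF zero = 0ℚ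
HF (suc n) = HF n + invFibSuc n

sumBelow : ℕ → (ℕ → ℚ) → ℚ
sumBelow zero f = 0ℚ
sumBelow (suc n) f = sumBelow n f + f n

-- Writing a_k = F_{k-1} 𝔽_k ≥ 0, Abel summation gives F_n 𝔽_n − n = Σ_{k<n} a_k.
-- The lower bound is then (Σ a_k)² ≥ Σ a_k², valid for nonnegative terms, and the
-- upper bound is the Cauchy–Schwarz inequality (Σ a_k)² ≤ n Σ a_k², proved by
-- induction on n using Σ_{k<n} (a_k − x)² ≥ 0 with x = a_n.

module Submission where

open import Defs
open import Data.Nat as ℕ using (ℕ; _≥_; zero; suc)
open import Data.Integer as ℤ using (+_)
import Data.Integer.Properties as ℤ
open import Data.Integer.Tactic.RingSolver using (solve-∀)
open import Data.Product using (_×_; _,_)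
open import Data.Sum using (inj₁; inj₂)
open import Data.Rational
  using (ℚ; _+_; _-_; _*_; _≤_; 0ℚ; 1ℚ; _/_; toℚᵘ; nonNegative; nonPositive)
import Data.Rational.Unnormalised as ℚᵘ
import Data.Rational.Unnormalised.Properties as ℚᵘ
open import Data.Rational.Properties
open import Data.Rational.Solver using (module +-*-Solver)
open import Relation.Binary.PropositionalEquality

open +-*-Solver

/1-homo-+ : ∀ i j → (i ℤ.+ j) / 1 ≡ i / 1 + j / 1
/1-homo-+ i j = toℚᵘ-injective (begin
  toℚᵘ ((i ℤ.+ j) / 1)              ≈⟨ toℚᵘ-fromℚᵘ ((i ℤ.+ j) ℚᵘ./ 1) ⟩
  (i ℤ.+ j) ℚᵘ./ 1                  ≈⟨ ℚᵘ.*≡* (cross-multiplied i j) ⟩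
  i ℚᵘ./ 1 ℚᵘ.+ j ℚᵘ./ 1            ≈⟨ ℚᵘ.+-cong (toℚᵘ-fromℚᵘ (i ℚᵘ./ 1)) (toℚᵘ-fromℚᵘ (j ℚᵘ./ 1)) ⟨
  toℚᵘ (i / 1) ℚᵘ.+ toℚᵘ (j / 1)    ≈⟨ toℚᵘ-homo-+ (i / 1) (j / 1) ⟨
  toℚᵘ (i / 1 + j / 1)              ∎)
  where
    open ℚᵘ.≃-Reasoning
    cross-multiplied : ∀ i j → (i ℤ.+ j) ℤ.* + 1 ≡ (i ℤ.* + 1 ℤ.+ j ℤ.* + 1) ℤ.* + 1
    cross-multiplied = solve-∀

/1-homo-* : ∀ i j → (i ℤ.* j) / 1 ≡ (i / 1) * (j / 1)
/1-homo-* i j = toℚᵘ-injective (begin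
  toℚᵘ ((i ℤ.* j) / 1)              ≈⟨ toℚᵘ-fromℚᵘ ((i ℤ.* j) ℚᵘ./ 1) ⟩
  (i ℤ.* j) ℚᵘ./ 1                  ≈⟨ ℚᵘ.*≡* refl ⟩
  (i ℚᵘ./ 1) ℚᵘ.* (j ℚᵘ./ 1)        ≈⟨ ℚᵘ.*-cong (toℚᵘ-fromℚᵘ (i ℚᵘ./ 1)) (toℚᵘ-fromℚᵘ (j ℚᵘ./ 1)) ⟨
  toℚᵘ (i / 1) ℚᵘ.* toℚᵘ (j / 1)    ≈⟨ toℚᵘ-homo-* (i / 1) (j / 1) ⟨
  toℚᵘ ((i / 1) * (j / 1))          ∎)
  where open ℚᵘ.≃-Reasoning

n/1*1/n≡1 : ∀ n .{{_ : ℕ.NonZero n}} → (+ n / 1) * (+ 1 / n) ≡ 1ℚ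
n/1*1/n≡1 (suc d) = toℚᵘ-injective (begin
  toℚᵘ ((+ suc d / 1) * (+ 1 / suc d))          ≈⟨ toℚᵘ-homo-* (+ suc d / 1) (+ 1 / suc d) ⟩
  toℚᵘ (+ suc d / 1) ℚᵘ.* toℚᵘ (+ 1 / suc d)    ≈⟨ ℚᵘ.*-cong (toℚᵘ-fromℚᵘ (+ suc d ℚᵘ./ 1)) (toℚᵘ-fromℚᵘ (+ 1 ℚᵘ./ suc d)) ⟩
  (+ suc d ℚᵘ./ 1) ℚᵘ.* (+ 1 ℚᵘ./ suc d)        ≈⟨ ℚᵘ.*≡* (cross-multiplied (+ suc d)) ⟩
  ℚᵘ.1ℚᵘ                                        ∎)
  where
    open ℚᵘ.≃-Reasoning
    cross-multiplied : ∀ n → (n ℤ.* + 1) ℤ.* + 1 ≡ + 1 ℤ.* (+ 1 ℤ.* n)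
    cross-multiplied = solve-∀

0≤+m/n : ∀ m n .{{_ : ℕ.NonZero n}} → 0ℚ ≤ + m / n
0≤+m/n m n = nonNegative⁻¹ (+ m / n) {{normalize-nonNeg m n}}

0≤p*p : ∀ p → 0ℚ ≤ p * p
0≤p*p p with ≤-total 0ℚ p
... | inj₁ 0≤p = nonNegative⁻¹ (p * p) {{nonNeg*nonNeg⇒nonNeg p {{nonNegative 0≤p}} p {{nonNegative 0≤p}}}}
... | inj₂ p≤0 = nonNegative⁻¹ (p * p) {{nonPos*nonPos⇒nonPos p {{nonPositive p≤0}} p {{nonPositive p≤0}}}}

0≤p*q : ∀ {p q} → 0ℚ ≤ p → 0ℚ ≤ q → 0ℚ ≤ p * q
0≤p*q {p} {q} 0≤p 0≤q = nonNegative⁻¹ (p * q) {{nonNeg*nonNeg⇒nonNeg p {{nonNegative 0≤p}} q {{nonNegative 0≤q}}}}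

p≤p+q : ∀ p {q} → 0ℚ ≤ q → p ≤ p + q
p≤p+q p {q} 0≤q = subst (_≤ p + q) (+-identityʳ p) (+-monoʳ-≤ p 0≤q)

fromℕ : ℕ → ℚ
fromℕ m = + m / 1

fromℕ-+ : ∀ m n → fromℕ (m ℕ.+ n) ≡ fromℕ m + fromℕ n
fromℕ-+ m n = trans (cong (_/ 1) (ℤ.pos-+ m n)) (/1-homo-+ (+ m) (+ n))

fromℕ-* : ∀ m n → fromℕ (m ℕ.* n) ≡ fromℕ m * fromℕ n
fromℕ-* m n = trans (cong (_/ 1) (ℤ.pos-* m n)) (/1-homo-* (+ m) (+ n))

fromℕ-suc : ∀ n → fromℕ (suc n) ≡ 1ℚ + fromℕ n
fromℕ-suc = fromℕ-+ 1

0≤fromℕ : ∀ n → 0ℚ ≤ fromℕ n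
0≤fromℕ n = 0≤+m/n n 1

sumBelow-cong : ∀ {f g} → (∀ k → f k ≡ g k) → ∀ n → sumBelow n f ≡ sumBelow n g
sumBelow-cong f≡g zero = refl
sumBelow-cong f≡g (suc n) = cong₂ _+_ (sumBelow-cong f≡g n) (f≡g n)

sumBelow-nonNeg : ∀ {f} → (∀ k → 0ℚ ≤ f k) → ∀ n → 0ℚ ≤ sumBelow n f
sumBelow-nonNeg 0≤f zero = ≤-refl
sumBelow-nonNeg 0≤f (suc n) = +-mono-≤ (sumBelow-nonNeg 0≤f n) (0≤f n)

module _ (f : ℕ → ℚ) where

  squares : ℕ → ℚ
  squares k = f k * f k

  sumBelow-squares≤square : (∀ k → 0ℚ ≤ f k) → ∀ n → sumBelow n squares ≤ sumBelow n f * sumBelow n f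
  sumBelow-squares≤square 0≤f zero = ≤-refl
  sumBelow-squares≤square 0≤f (suc n) = begin
    Q + b * b                   ≤⟨ +-monoˡ-≤ (b * b) (sumBelow-squares≤square 0≤f n) ⟩
    S * S + b * b               ≤⟨ p≤p+q (S * S + b * b) (0≤p*q (+-mono-≤ (0≤f n) (0≤f n)) (sumBelow-nonNeg 0≤f n)) ⟩
    S * S + b * b + (b + b) * S ≡⟨ solve 2 (λ S b → S :* S :+ b :* b :+ (b :+ b) :* S := (S :+ b) :* (S :+ b)) refl S b ⟩
    (S + b) * (S + b)           ∎
    where
      open ≤-Reasoning
      S = sumBelow n f
      Q = sumBelow n squares
      b = f n

  sumBelow-squared-deviations : ∀ x n → sumBelow n (λ k → (f k - x) * (f k - x))
    ≡ sumBelow n squares - (x + x) * sumBelow n f + fromℕ n * (x * x)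
  sumBelow-squared-deviations x zero = solve 1 (λ x → con 0ℚ := con 0ℚ :- (x :+ x) :* con 0ℚ :+ con 0ℚ :* (x :* x)) refl x
  sumBelow-squared-deviations x (suc n) = begin
    D + (b - x) * (b - x)
      ≡⟨ cong (_+ (b - x) * (b - x)) (sumBelow-squared-deviations x n) ⟩
    Q - (x + x) * S + m * (x * x) + (b - x) * (b - x)
      ≡⟨ solve 5 (λ Q S m b x → Q :- (x :+ x) :* S :+ m :* (x :* x) :+ (b :- x) :* (b :- x)
                  := (Q :+ b :* b) :- (x :+ x) :* (S :+ b) :+ (con 1ℚ :+ m) :* (x :* x)) refl Q S m b x ⟩
    (Q + b * b) - (x + x) * (S + b) + (1ℚ + m) * (x * x)
      ≡⟨ cong (λ t → (Q + b * b) - (x + x) * (S + b) + t * (x * x)) (fromℕ-suc n) ⟨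
    (Q + b * b) - (x + x) * (S + b) + fromℕ (suc n) * (x * x) ∎
    where
      open ≡-Reasoning
      D = sumBelow n (λ k → (f k - x) * (f k - x))
      S = sumBelow n f
      Q = sumBelow n squares
      m = fromℕ n
      b = f n

  cauchy-schwarz : ∀ n → sumBelow n f * sumBelow n f ≤ fromℕ n * sumBelow n squares
  cauchy-schwarz zero = ≤-refl
  cauchy-schwarz (suc n) = begin
    (S + b) * (S + b)
      ≡⟨ solve 2 (λ S b → (S :+ b) :* (S :+ b) := S :* S :+ ((b :+ b) :* S :+ b :* b)) refl S b ⟩
    S * S + ((b + b) * S + b * b)
      ≤⟨ +-monoˡ-≤ ((b + b) * S + b * b) (cauchy-schwarz n) ⟩
    m * Q + ((b + b) * S + b * b)
      ≤⟨ p≤p+q (m * Q + ((b + b) * S + b * b)) 0≤deviations ⟩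
    m * Q + ((b + b) * S + b * b) + (Q - (b + b) * S + m * (b * b))
      ≡⟨ solve 4 (λ Q S m b → m :* Q :+ ((b :+ b) :* S :+ b :* b) :+ (Q :- (b :+ b) :* S :+ m :* (b :* b))
                  := (con 1ℚ :+ m) :* (Q :+ b :* b)) refl Q S m b ⟩
    (1ℚ + m) * (Q + b * b)
      ≡⟨ cong (_* (Q + b * b)) (fromℕ-suc n) ⟨
    fromℕ (suc n) * (Q + b * b) ∎
    where
      open ≤-Reasoning
      S = sumBelow n f
      Q = sumBelow n squares
      m = fromℕ n
      b = f n
      0≤deviations : 0ℚ ≤ Q - (b + b) * S + m * (b * b)
      0≤deviations = subst (0ℚ ≤_) (sumBelow-squared-deviations b n) (sumBelow-nonNeg (λ k → 0≤p*p (f k - b)) n)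

fib-suc : ∀ n → fib (suc n) ≡ fib n ℕ.+ fibPrev n
fib-suc zero = refl
fib-suc (suc n) = refl

fib*invFibSuc≡1 : ∀ n → fromℕ (fib (suc n)) * invFibSuc n ≡ 1ℚ
fib*invFibSuc≡1 n = n/1*1/n≡1 (fib (suc n)) {{ℕ.>-nonZero (fib-suc-pos n)}}

0≤HF : ∀ n → 0ℚ ≤ HF n
0≤HF zero = ≤-refl
0≤HF (suc n) = +-mono-≤ (0≤HF n) (0≤+m/n 1 (fib (suc n)) {{ℕ.>-nonZero (fib-suc-pos n)}})

fibPrev*HF : ℕ → ℚ
fibPrev*HF k = fromℕ (fibPrev k) * HF k

0≤fibPrev*HF : ∀ k → 0ℚ ≤ fibPrev*HF k
0≤fibPrev*HF k = 0≤p*q (0≤fromℕ (fibPrev k)) (0≤HF k)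

-- Abel summation: F_{n+1} 𝔽_{n+1} = (F_n + F_{n-1}) 𝔽_n + 1.
fib*HF-n≡sumBelow : ∀ n → fromℕ (fib n) * HF n - fromℕ n ≡ sumBelow n fibPrev*HF
fib*HF-n≡sumBelow zero = refl
fib*HF-n≡sumBelow (suc n) = begin
  F′ * (h + v) - fromℕ (suc n)
    ≡⟨ cong₂ _-_ (*-distribˡ-+ F′ h v) (fromℕ-suc n) ⟩
  F′ * h + F′ * v - (1ℚ + m)
    ≡⟨ cong₂ (λ a b → a * h + b - (1ℚ + m)) F′≡x+y (fib*invFibSuc≡1 n) ⟩
  (x + y) * h + 1ℚ - (1ℚ + m)
    ≡⟨ solve 4 (λ x y h m → (x :+ y) :* h :+ con 1ℚ :- (con 1ℚ :+ m) := (x :* h :- m) :+ y :* h) refl x y h m ⟩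
  (x * h - m) + y * h
    ≡⟨ cong (_+ y * h) (fib*HF-n≡sumBelow n) ⟩
  sumBelow n fibPrev*HF + y * h ∎
  where
    open ≡-Reasoning
    F′ = fromℕ (fib (suc n))
    x = fromℕ (fib n)
    y = fromℕ (fibPrev n)
    h = HF n
    v = invFibSuc n
    m = fromℕ n
    F′≡x+y : F′ ≡ x + y
    F′≡x+y = trans (cong fromℕ (fib-suc n)) (fromℕ-+ (fib n) (fibPrev n))

fibPrev²*HF²≡squares : ∀ k → (+ (fibPrev k ℕ.* fibPrev k) / 1) * (HF k * HF k) ≡ squares fibPrev*HF k
fibPrev²*HF²≡squares k = begin
  fromℕ (p ℕ.* p) * (h * h)      ≡⟨ cong (_* (h * h)) (fromℕ-* p p) ⟩
  fromℕ p * fromℕ p * (h * h)    ≡⟨ solve 2 (λ p h → p :* p :* (h :* h) := p :* h :* (p :* h)) refl (fromℕ p) h ⟩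
  fibPrev*HF k * fibPrev*HF k    ∎
  where
    open ≡-Reasoning
    p = fibPrev k
    h = HF k

corollary3p4 : (n : ℕ) → n ≥ 1 →
    let A = sumBelow n (λ k → ((+ (fibPrev k ℕ.* fibPrev k)) / 1) * (HF k * HF k))
        B = (+ fib n / 1) * HF n - (+ n / 1)
    in (0ℚ ≤ B) × (A ≤ B * B) × (B * B ≤ (+ n / 1) * A)
corollary3p4 n _ = subst₂ Claim (sym A≡Q) (sym (fib*HF-n≡sumBelow n))
  ( sumBelow-nonNeg 0≤fibPrev*HF n
  , sumBelow-squares≤square fibPrev*HF 0≤fibPrev*HF n
  , cauchy-schwarz fibPrev*HF n )
  where
    Claim : ℚ → ℚ → Set
    Claim A B = (0ℚ ≤ B) × (A ≤ B * B) × (B * B ≤ fromℕ n * A)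
    A≡Q : sumBelow n (λ k → (+ (fibPrev k ℕ.* fibPrev k) / 1) * (HF k * HF k)) ≡ sumBelow n (squares fibPrev*HF)
    A≡Q = sumBelow-cong fibPrev²*HF²≡squares n
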